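{- Let $p$ be an odd prime, $n\ge1$, $F=\mathbb{F}_{p^n}$. Then the inverse permutation $f\colon F\to F$, $f(x)=x^{p^n-2}$ (so $f(x)=x^{ -1}$ for $x\ne0$ and $f(0)=0$), is a GAPN function.
   Context: $\tilde D_af(x)=\sum_{j\in\mathbb{F}_p}f(x+ja)$, $\tilde N_f(a,b)=\#\{x\in F:\tilde D_af(x)=b\}$; $f$ is GAPN if $\tilde N_f(a,b)\le p$ for all $a\in F^\times$, $b\in F$. -}

module Defs where

open import Level using (0ℓ)
open import Data.Nat as ℕ using (ℕ; zero; suc)
open import Data.Fin using (Fin)
open import Data.List using (List; map; filter; length)
open import Data.List.Base using (allFin)
open import Data.Product using (Σ; _,_)
open import Relation.Nullary using (¬_; Dec)
open import Relation.Binary.PropositionalEquality using (_≡_; _≢_)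
open import Algebra.Structures using (IsCommutativeRing)
open import Function.Bundles using (_↔_; Inverse)

record Field : Set₁ where
  infixl 7 _*_
  infixl 6 _+_
  field
    Carrier : Set
    _+_ _*_ : Carrier → Carrier → Carrier
    -_      : Carrier → Carrier
    0# 1#   : Carrier
    isCommutativeRing : IsCommutativeRing _≡_ _+_ _*_ -_ 0# 1#
    0≢1     : 0# ≢ 1#
    inverse : ∀ x → x ≢ 0# → Σ Carrier (λ y → x * y ≡ 1#)
    _≟_     : (x y : Carrier) → Dec (x ≡ y)

  _·_ : ℕ → Carrier → Carrier
  zero  · a = 0#
  suc j · a = a + (j · a)

  _^_ : Carrier → ℕ → Carrier
  x ^ zero  = 1#
  x ^ suc m = x * (x ^ m)

module _ (F : Field) where
  open Field F

  sumUpTo : ℕ → (ℕ → Carrier) → Carrier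
  sumUpTo zero    g = 0#
  sumUpTo (suc k) g = g k + sumUpTo k g

  -- \tilde D_a f (x) = Σ_{j ∈ F_p} f (x + j a), with F_p = {j·1 : 0 ≤ j < p}
  D̃ : (p : ℕ) → (Carrier → Carrier) → Carrier → Carrier → Carrier
  D̃ p f a x = sumUpTo p (λ j → f (x + (j · a)))

  -- \tilde N_f(a,b) = #{x ∈ F : \tilde D_a f(x) = b}, counted through an
  -- enumeration  e : Fin q ↔ F  of all elements of F.
  Ñ : (p : ℕ) {q : ℕ} → (Fin q ↔ Carrier) → (Carrier → Carrier) → Carrier → Carrier → ℕ
  Ñ p {q} e f a b =
    length (filter (λ x → D̃ p f a x ≟ b) (map (Inverse.to e) (allFin q)))

  IsGAPN : (p : ℕ) {q : ℕ} → (Fin q ↔ Carrier) → (Carrier → Carrier) → Set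
  IsGAPN p e f = ∀ a → a ≢ 0# → ∀ b → Ñ p e f a b ℕ.≤ p

module Submission where

-- For a ≠ 0,
--   D̃_a inv (x) = ∑_{j<p} inv (x + j a) = inv a · T (x / a),
-- where T(t) = ∑_{j<p} inv (t + j) sums inv over the translate t + 𝔽ₚ.  The
-- heart of the proof (module ReciprocalSum) is that T(t) = T(s) forces
-- s - t ∈ 𝔽ₚ.  It uses P(t) = ∏_{j<p} (t + j), which vanishes exactly on 𝔽ₚ
-- and is additive, and the identity T · P = E with E the derivative of P,
-- which is constant and nonzero off 𝔽ₚ.  So every fibre of D̃_a inv lies on a
-- line x₀ + 𝔽ₚ a and has at most p elements (GAPN-from-fibres).

open import Defs

open import Level using (0ℓ)
open import Data.Nat as ℕ using (ℕ; zero; suc)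
import Data.Nat.Properties as ℕP
open import Data.Nat.DivMod using (_%_; _/_; m≡m%n+[m/n]*n; m%n<n)
open import Data.Nat.Primality using (Prime; prime⇒nonZero; ¬prime[1])
open import Data.Nat.Coprimality using (prime⇒coprime; coprime-Bézout)
open import Data.Nat.GCD using (module Bézout)
open import Data.Integer as ℤ using (ℤ)
import Data.Integer.Properties as ℤP
open import Data.Sign as Sign using (Sign)
open import Data.Fin using (Fin; zero; suc; toℕ)
import Data.Fin.Properties as FinP
open import Data.Fin.Permutation using (Permutation)
open import Data.Vec using (Vec; []; _∷_; replicate)
open import Data.Vec.Functional using (removeAt)
open import Data.List using (List; []; _∷_; _++_; length; map; filter; upTo; allFin)
import Data.List.Properties as ListP
open import Data.List.Membership.Propositional using (_∈_)
import Data.List.Membership.Propositional.Properties as Membership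
open import Data.List.Relation.Unary.Any using (here; there)
import Data.List.Relation.Unary.All as All
open import Data.List.Relation.Unary.AllPairs using (_∷_)
open import Data.List.Relation.Unary.Unique.Propositional using (Unique)
import Data.List.Relation.Unary.Unique.Propositional.Properties as UniqueP
open import Data.Maybe using (Maybe; just; nothing)
open import Data.Empty using (⊥; ⊥-elim)
open import Data.Product using (Σ; _,_; proj₂; _×_)
open import Data.Sum using (inj₁; inj₂)
open import Function.Bundles using (_↔_; Inverse; mk↔ₛ′)
open import Relation.Nullary using (yes; no)
open import Relation.Binary.PropositionalEquality
open import Algebra.Bundles using (CommutativeRing; CommutativeMonoid)
open import Algebra.Structures using (IsCommutativeRing; IsCommutativeMonoid)
import Algebra.Definitions.RawMonoid as RawMonoidDefinitions
import Algebra.Properties.CommutativeMonoid.Sum as CommutativeMonoidSum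
import Algebra.Properties.Group as GroupProperties
import Algebra.Properties.Ring as RingProperties
import Algebra.Properties.Semiring.Mult as SemiringMult
import Algebra.Solver.Ring
open import Algebra.Solver.Ring.AlmostCommutativeRing
  using (_-Raw-AlmostCommutative⟶_; fromCommutativeRing)

-- In every commutative ring (with propositional equality) the canonical map
-- ι : ℤ → R is a ring homomorphism; this makes the ring solver with integer
-- coefficients available for R.
module IntegerCoefficients {A : Set} {add mul : A → A → A} {neg : A → A} {z u : A}
    (isCR : IsCommutativeRing _≡_ add mul neg z u) where

  R : CommutativeRing 0ℓ 0ℓ
  R = record { isCommutativeRing = isCR }

  open CommutativeRing R using (_+_; _*_; -_; 0#; 1#; +-assoc; +-comm; *-comm; +-identityˡ; +-identityʳ;
    *-identityˡ; *-identityʳ; *-assoc; zeroʳ; -‿inverseʳ; semiring; ring)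
  open RingProperties ring using (-‿involutive; -‿distribˡ-*; -‿distribʳ-*; -‿anti-homo-+; -0#≈0#)
  open SemiringMult semiring using (×-homo-+; ×1-homo-*) renaming (_×_ to _times_)
  open ≡-Reasoning

  ι : ℤ → A
  ι (ℤ.+ n)    = n times 1#
  ι ℤ.-[1+ n ] = - (suc n times 1#)

  ι-⊖ : ∀ m n → ι (m ℤ.⊖ n) ≡ m times 1# + - (n times 1#)
  ι-⊖ m       zero    = begin
    ι (m ℤ.⊖ 0)   ≡⟨ cong ι (ℤP.⊖-≥ {m} ℕ.z≤n) ⟩
    M             ≡⟨ sym (+-identityʳ M) ⟩
    M + 0#        ≡⟨ cong (M +_) (sym -0#≈0#) ⟩
    M + - 0#      ∎
    where M = m times 1#
  ι-⊖ zero    (suc n) = sym (+-identityˡ _)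
  ι-⊖ (suc m) (suc n) = begin
    ι (suc m ℤ.⊖ suc n)            ≡⟨ cong ι (ℤP.[1+m]⊖[1+n]≡m⊖n m n) ⟩
    ι (m ℤ.⊖ n)                    ≡⟨ ι-⊖ m n ⟩
    M + - N                        ≡⟨ cong (_+ - N) (sym (+-identityˡ M)) ⟩
    (0# + M) + - N                 ≡⟨ cong (λ z → (z + M) + - N) (sym (-‿inverseʳ 1#)) ⟩
    ((1# + - 1#) + M) + - N        ≡⟨ cong (_+ - N) (+-assoc 1# (- 1#) M) ⟩
    (1# + (- 1# + M)) + - N        ≡⟨ cong (λ z → (1# + z) + - N) (+-comm (- 1#) M) ⟩
    (1# + (M + - 1#)) + - N        ≡⟨ cong (_+ - N) (sym (+-assoc 1# M (- 1#))) ⟩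
    ((1# + M) + - 1#) + - N        ≡⟨ +-assoc (1# + M) (- 1#) (- N) ⟩
    (1# + M) + (- 1# + - N)        ≡⟨ cong ((1# + M) +_) (sym (-‿anti-homo-+ N 1#)) ⟩
    (1# + M) + - (N + 1#)          ≡⟨ cong (λ z → (1# + M) + - z) (+-comm N 1#) ⟩
    (1# + M) + - (1# + N)          ∎
    where
    M = m times 1#
    N = n times 1#

  ι-+ : ∀ i j → ι (i ℤ.+ j) ≡ ι i + ι j
  ι-+ (ℤ.+ m)    (ℤ.+ n)    = ×-homo-+ 1# m n
  ι-+ (ℤ.+ m)    ℤ.-[1+ n ] = ι-⊖ m (suc n)
  ι-+ ℤ.-[1+ m ] (ℤ.+ n)    = trans (ι-⊖ n (suc m)) (+-comm _ _)
  ι-+ ℤ.-[1+ m ] ℤ.-[1+ n ] = begin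
    - (suc (suc (m ℕ.+ n)) times 1#)          ≡⟨ cong (λ k → - (k times 1#)) (sym (ℕP.+-suc (suc m) n)) ⟩
    - ((suc m ℕ.+ suc n) times 1#)            ≡⟨ cong -_ (×-homo-+ 1# (suc m) (suc n)) ⟩
    - (suc m times 1# + suc n times 1#)       ≡⟨ -‿anti-homo-+ _ _ ⟩
    - (suc n times 1#) + - (suc m times 1#)   ≡⟨ +-comm _ _ ⟩
    - (suc m times 1#) + - (suc n times 1#)   ∎

  ι-neg : ∀ i → ι (ℤ.- i) ≡ - ι i
  ι-neg (ℤ.+ zero)    = sym -0#≈0#
  ι-neg (ℤ.+ suc n)   = refl
  ι-neg ℤ.-[1+ n ]    = sym (-‿involutive _)

  -- ℤ's multiplication works with signs and absolute values: i * j is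
  -- (sign i · sign j) ◃ (∣i∣ ∣j∣), so ι is compared with σ (sign) · ∣ ∣ times 1
  σ : Sign → A
  σ Sign.+ = 1#
  σ Sign.- = - 1#

  σ-* : ∀ s t → σ (s Sign.* t) ≡ σ s * σ t
  σ-* Sign.+ t      = sym (*-identityˡ _)
  σ-* Sign.- Sign.+ = sym (*-identityʳ _)
  σ-* Sign.- Sign.- = begin
    1#             ≡⟨ sym (-‿involutive 1#) ⟩
    - - 1#         ≡⟨ cong -_ (sym (*-identityʳ (- 1#))) ⟩
    - (- 1# * 1#)  ≡⟨ -‿distribʳ-* (- 1#) 1# ⟩
    - 1# * - 1#    ∎

  ι-◃ : ∀ s n → ι (s ℤ.◃ n) ≡ σ s * (n times 1#)
  ι-◃ Sign.+ zero    = sym (zeroʳ _)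
  ι-◃ Sign.- zero    = sym (zeroʳ _)
  ι-◃ Sign.+ (suc n) = sym (*-identityˡ _)
  ι-◃ Sign.- (suc n) = trans (cong -_ (sym (*-identityˡ _))) (-‿distribˡ-* 1# _)

  ι-signAbs : ∀ i → ι i ≡ σ (ℤ.sign i) * (ℤ.∣ i ∣ times 1#)
  ι-signAbs i = trans (cong ι (sym (ℤP.◃-inverse i))) (ι-◃ (ℤ.sign i) ℤ.∣ i ∣)

  *-interchange : ∀ a b c d → (a * b) * (c * d) ≡ (a * c) * (b * d)
  *-interchange a b c d = begin
    (a * b) * (c * d)  ≡⟨ *-assoc a b _ ⟩
    a * (b * (c * d))  ≡⟨ cong (a *_) (sym (*-assoc b c d)) ⟩
    a * ((b * c) * d)  ≡⟨ cong (λ z → a * (z * d)) (*-comm b c) ⟩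
    a * ((c * b) * d)  ≡⟨ cong (a *_) (*-assoc c b d) ⟩
    a * (c * (b * d))  ≡⟨ sym (*-assoc a c _) ⟩
    (a * c) * (b * d)  ∎

  ι-* : ∀ i j → ι (i ℤ.* j) ≡ ι i * ι j
  ι-* i j = begin
    ι (i ℤ.* j)
      ≡⟨ ι-◃ (ℤ.sign i Sign.* ℤ.sign j) (ℤ.∣ i ∣ ℕ.* ℤ.∣ j ∣) ⟩
    σ (ℤ.sign i Sign.* ℤ.sign j) * ((ℤ.∣ i ∣ ℕ.* ℤ.∣ j ∣) times 1#)
      ≡⟨ cong₂ _*_ (σ-* (ℤ.sign i) (ℤ.sign j)) (×1-homo-* ℤ.∣ i ∣ ℤ.∣ j ∣) ⟩
    (σ (ℤ.sign i) * σ (ℤ.sign j)) * ((ℤ.∣ i ∣ times 1#) * (ℤ.∣ j ∣ times 1#))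
      ≡⟨ *-interchange _ _ _ _ ⟩
    (σ (ℤ.sign i) * (ℤ.∣ i ∣ times 1#)) * (σ (ℤ.sign j) * (ℤ.∣ j ∣ times 1#))
      ≡⟨ sym (cong₂ _*_ (ι-signAbs i) (ι-signAbs j)) ⟩
    ι i * ι j ∎

  ι-homomorphism : ℤ.+-*-rawRing -Raw-AlmostCommutative⟶ fromCommutativeRing R
  ι-homomorphism = record
    { ⟦_⟧ = ι ; +-homo = ι-+ ; *-homo = ι-* ; -‿homo = ι-neg
    ; 0-homo = refl ; 1-homo = +-identityʳ 1# }

  ι-equal? : ∀ i j → Maybe (ι i ≡ ι j)
  ι-equal? i j with i ℤ.≟ j
  ... | yes i≡j = just (cong ι i≡j)
  ... | no _    = nothing

  open Algebra.Solver.Ring ℤ.+-*-rawRing (fromCommutativeRing R) ι-homomorphism ι-equal? public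
    using (solve; _:+_; _:*_; _:-_; :-_; _:=_; con)

module RangeFold {A : Set} {op : A → A → A} {e : A}
    (isCM : IsCommutativeMonoid _≡_ op e) where
  open IsCommutativeMonoid isCM using (assoc; comm; identityˡ; identityʳ)
  open ≡-Reasoning

  infixl 7 _∙_
  _∙_ : A → A → A
  _∙_ = op

  fold : ℕ → (ℕ → A) → A
  fold zero    g = e
  fold (suc k) g = g k ∙ fold k g

  fold-cong : ∀ k {g h} → (∀ j → j ℕ.< k → g j ≡ h j) → fold k g ≡ fold k h
  fold-cong zero    g≡h = refl
  fold-cong (suc k) g≡h =
    cong₂ _∙_ (g≡h k ℕP.≤-refl) (fold-cong k (λ j j<k → g≡h j (ℕP.m≤n⇒m≤1+n j<k)))

  fold-split₀ : ∀ k g → fold k (λ j → g (suc j)) ∙ g 0 ≡ fold (suc k) g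
  fold-split₀ zero    g = trans (identityˡ _) (sym (identityʳ _))
  fold-split₀ (suc k) g = trans (assoc _ _ _) (cong (g (suc k) ∙_) (fold-split₀ k g))

  fold-cyclic : ∀ k g → g k ≡ g 0 → fold k (λ j → g (suc j)) ≡ fold k g
  fold-cyclic zero     g _     = refl
  fold-cyclic (suc k) g gk≡g0 = begin
    g (suc k) ∙ fold k (λ j → g (suc j))  ≡⟨ cong (_∙ fold k (λ j → g (suc j))) gk≡g0 ⟩
    g 0 ∙ fold k (λ j → g (suc j))        ≡⟨ comm _ _ ⟩
    fold k (λ j → g (suc j)) ∙ g 0        ≡⟨ fold-split₀ k g ⟩
    fold (suc k) g                        ∎

  fold-reverse : ∀ k g → fold k (λ j → g (k ℕ.∸ suc j)) ≡ fold k g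
  fold-reverse zero    g = refl
  fold-reverse (suc k) g = begin
    g (k ℕ.∸ k) ∙ fold k (λ j → g (suc k ℕ.∸ suc j))
      ≡⟨ cong₂ _∙_ (cong g (ℕP.n∸n≡0 k)) (fold-cong k (λ j j<k → cong g (ℕP.+-∸-assoc 1 j<k))) ⟩
    g 0 ∙ fold k (λ j → g (suc (k ℕ.∸ suc j)))  ≡⟨ cong (g 0 ∙_) (fold-reverse k (λ j → g (suc j))) ⟩
    g 0 ∙ fold k (λ j → g (suc j))              ≡⟨ comm _ _ ⟩
    fold k (λ j → g (suc j)) ∙ g 0              ≡⟨ fold-split₀ k g ⟩
    fold (suc k) g                              ∎

module FieldAlgebra (F : Field) where
  open Field F public
  open IsCommutativeRing isCommutativeRing public
    using (+-assoc; +-comm; *-assoc; *-comm; distribˡ; distribʳ;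
           +-identityˡ; +-identityʳ; *-identityˡ; *-identityʳ;
           -‿inverseʳ; zeroˡ; zeroʳ)
  open IntegerCoefficients isCommutativeRing public
    using (solve; _:+_; _:*_; _:-_; :-_; _:=_; con)
  open RingProperties (CommutativeRing.ring (IntegerCoefficients.R isCommutativeRing)) public
    using (-‿involutive; -0#≈0#; -1*x≈-x)
  open GroupProperties (CommutativeRing.+-group (IntegerCoefficients.R isCommutativeRing)) public
    using () renaming (x∙y⁻¹≈ε⇒x≈y to difference-zero; x≈y⇒x∙y⁻¹≈ε to difference-self;
                      inverseʳ-unique to negation-unique)
  open ≡-Reasoning

  infixl 6 _-_
  _-_ : Carrier → Carrier → Carrier
  x - y = x + - y

  +-cancelˡ : ∀ a {x y} → a + x ≡ a + y → x ≡ y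
  +-cancelˡ a {x} {y} e = begin
    x              ≡⟨ solve 2 (λ a x → x := :- a :+ (a :+ x)) refl a x ⟩
    - a + (a + x)  ≡⟨ cong (- a +_) e ⟩
    - a + (a + y)  ≡⟨ solve 2 (λ a y → :- a :+ (a :+ y) := y) refl a y ⟩
    y              ∎

  ·-+ : ∀ m n a → (m ℕ.+ n) · a ≡ m · a + n · a
  ·-+ zero    n a = sym (+-identityˡ _)
  ·-+ (suc m) n a = trans (cong (a +_) (·-+ m n a)) (sym (+-assoc a _ _))

  ·-scales : ∀ m a → m · a ≡ (m · 1#) * a
  ·-scales zero    a = sym (zeroˡ a)
  ·-scales (suc m) a = begin
    a + m · a               ≡⟨ cong₂ _+_ (sym (*-identityˡ a)) (·-scales m a) ⟩
    1# * a + (m · 1#) * a   ≡⟨ sym (distribʳ a 1# (m · 1#)) ⟩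
    (1# + m · 1#) * a       ∎

  ·-* : ∀ m n → (m ℕ.* n) · 1# ≡ (m · 1#) * (n · 1#)
  ·-* zero    n = sym (zeroˡ _)
  ·-* (suc m) n = begin
    (n ℕ.+ m ℕ.* n) · 1#                 ≡⟨ ·-+ n (m ℕ.* n) 1# ⟩
    n · 1# + (m ℕ.* n) · 1#              ≡⟨ cong₂ _+_ (sym (*-identityˡ _)) (·-* m n) ⟩
    1# * (n · 1#) + (m · 1#) * (n · 1#)  ≡⟨ sym (distribʳ _ 1# (m · 1#)) ⟩
    (1# + m · 1#) * (n · 1#)             ∎

  zero-product : ∀ {a b} → a * b ≡ 0# → a ≢ 0# → b ≡ 0#
  zero-product {a} {b} ab≡0 a≢0 with inverse a a≢0
  ... | c , ac≡1 = begin
    b            ≡⟨ sym (*-identityˡ b) ⟩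
    1# * b       ≡⟨ cong (_* b) (sym ac≡1) ⟩
    (a * c) * b  ≡⟨ solve 3 (λ a b c → (a :* c) :* b := c :* (a :* b)) refl a b c ⟩
    c * (a * b)  ≡⟨ cong (c *_) ab≡0 ⟩
    c * 0#       ≡⟨ zeroʳ c ⟩
    0#           ∎

  nonzero-product : ∀ {a b} → a ≢ 0# → b ≢ 0# → a * b ≢ 0#
  nonzero-product a≢0 b≢0 ab≡0 = b≢0 (zero-product ab≡0 a≢0)

  *-cancelˡ : ∀ {a b c} → a ≢ 0# → a * b ≡ a * c → b ≡ c
  *-cancelˡ {a} {b} {c} a≢0 ab≡ac = difference-zero b c (zero-product a[b-c]≡0 a≢0)
    where
    a[b-c]≡0 : a * (b - c) ≡ 0#
    a[b-c]≡0 = begin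
      a * (b - c)    ≡⟨ solve 3 (λ a b c → a :* (b :- c) := a :* b :- a :* c) refl a b c ⟩
      a * b - a * c  ≡⟨ difference-self ab≡ac ⟩
      0#             ∎

  inverse-unique : ∀ {a b c} → a * b ≡ 1# → a * c ≡ 1# → b ≡ c
  inverse-unique {a} {b} ab≡1 ac≡1 = *-cancelˡ a≢0 (trans ab≡1 (sym ac≡1))
    where
    a≢0 : a ≢ 0#
    a≢0 a≡0 = 0≢1 (trans (sym (zeroˡ b)) (trans (cong (_* b) (sym a≡0)) ab≡1))

module RangeSumsAndProducts (F : Field) where
  open FieldAlgebra F
  open IsCommutativeRing isCommutativeRing using (+-isCommutativeMonoid; *-isCommutativeMonoid)
  open ≡-Reasoning

  open RangeFold +-isCommutativeMonoid public using ()
    renaming (fold to ∑; fold-cong to ∑-cong; fold-cyclic to ∑-cyclic; fold-reverse to ∑-reverse)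
  open RangeFold *-isCommutativeMonoid public using ()
    renaming (fold to ∏; fold-cong to ∏-cong; fold-cyclic to ∏-cyclic)

  sumUpTo≡∑ : ∀ k g → sumUpTo F k g ≡ ∑ k g
  sumUpTo≡∑ zero    g = refl
  sumUpTo≡∑ (suc k) g = cong (g k +_) (sumUpTo≡∑ k g)

  ∑-scale : ∀ k c g → ∑ k (λ j → c * g j) ≡ c * ∑ k g
  ∑-scale zero    c g = sym (zeroʳ c)
  ∑-scale (suc k) c g = trans (cong (c * g k +_) (∑-scale k c g)) (sym (distribˡ c _ _))

  ∑-neg : ∀ k g → ∑ k (λ j → - g j) ≡ - ∑ k g
  ∑-neg zero    g = sym -0#≈0#
  ∑-neg (suc k) g = trans (cong (- g k +_) (∑-neg k g))
    (solve 2 (λ x y → :- x :+ :- y := :- (x :+ y)) refl (g k) (∑ k g))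

  ∏-zero : ∀ k g j → j ℕ.< k → g j ≡ 0# → ∏ k g ≡ 0#
  ∏-zero (suc k) g j j<1+k gj≡0 with j ℕ.≟ k
  ... | yes refl = trans (cong (_* ∏ k g) gj≡0) (zeroˡ _)
  ... | no j≢k   = trans (cong (g k *_) (∏-zero k g j (ℕP.≤∧≢⇒< (ℕP.≤-pred j<1+k) j≢k) gj≡0)) (zeroʳ _)

  ∏-zero⁻¹ : ∀ k g → ∏ k g ≡ 0# → Σ ℕ λ j → j ℕ.< k × g j ≡ 0#
  ∏-zero⁻¹ zero    g 1≡0 = ⊥-elim (0≢1 (sym 1≡0))
  ∏-zero⁻¹ (suc k) g ∏≡0 with g k ≟ 0#
  ... | yes gk≡0 = k , ℕP.≤-refl , gk≡0
  ... | no gk≢0 with ∏-zero⁻¹ k g (zero-product ∏≡0 gk≢0)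
  ...   | j , j<k , gj≡0 = j , ℕP.m≤n⇒m≤1+n j<k , gj≡0

module Polynomials (F : Field) where
  open FieldAlgebra F
  open RangeSumsAndProducts F
  open ≡-Reasoning

  -- Horner evaluation of the coefficient vector  c₀ ∷ c₁ ∷ … ∷ c_{m-1}
  eval : ∀ {m} → Vec Carrier m → Carrier → Carrier
  eval []       x = 0#
  eval (c ∷ cs) x = c + x * eval cs x

  PolyFn : ℕ → (Carrier → Carrier) → Set
  PolyFn m f = Σ (Vec Carrier m) λ c → ∀ x → f x ≡ eval c x

  divide : ∀ {m} r (c : Vec Carrier (suc m)) →
           Σ (Vec Carrier m) λ d → ∀ x → eval c x ≡ (x - r) * eval d x + eval c r
  divide {zero}  r (c₀ ∷ []) = [] , λ x →
    solve 3 (λ c₀ x r → c₀ :+ x :* con (ℤ.+ 0) := (x :- r) :* con (ℤ.+ 0) :+ (c₀ :+ r :* con (ℤ.+ 0)))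
      refl c₀ x r
  divide {suc m} r (c₀ ∷ cs) with divide r cs
  ... | d , cs≡ = (eval cs r ∷ d) , λ x → begin
    c₀ + x * eval cs x
      ≡⟨ cong (λ z → c₀ + x * z) (cs≡ x) ⟩
    c₀ + x * ((x - r) * eval d x + eval cs r)
      ≡⟨ solve 5 (λ c₀ x r A B → c₀ :+ x :* ((x :- r) :* B :+ A)
                   := (x :- r) :* (A :+ x :* B) :+ (c₀ :+ r :* A)) refl c₀ x r (eval cs r) (eval d x) ⟩
    (x - r) * (eval cs r + x * eval d x) + (c₀ + r * eval cs r) ∎

  -- the root bound, by induction on m: divide by  x - r₀  and apply the
  -- induction hypothesis to the quotient, which vanishes at the other roots
  root-bound : ∀ {m} (c : Vec Carrier m) (r : Fin m → Carrier) →
               (∀ {i j} → r i ≡ r j → i ≡ j) → (∀ i → eval c (r i) ≡ 0#) → ∀ x → eval c x ≡ 0#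
  root-bound []         r r-inj roots x = refl
  root-bound c@(_ ∷ _) r r-inj roots x with divide (r zero) c
  ... | d , c≡ = begin
    eval c x                                   ≡⟨ c≡ x ⟩
    (x - r zero) * eval d x + eval c (r zero)  ≡⟨ cong₂ (λ u v → (x - r zero) * u + v) (d≡0 x) (roots zero) ⟩
    (x - r zero) * 0# + 0#
      ≡⟨ solve 2 (λ x r → (x :- r) :* con (ℤ.+ 0) :+ con (ℤ.+ 0) := con (ℤ.+ 0)) refl x (r zero) ⟩
    0#                                         ∎
    where
    d-root : ∀ i → eval d (r (suc i)) ≡ 0#
    d-root i = zero-product factored r₁≢r₀
      where
      factored : (r (suc i) - r zero) * eval d (r (suc i)) ≡ 0#
      factored = begin
        q                       ≡⟨ sym (+-identityʳ q) ⟩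
        q + 0#                  ≡⟨ cong (q +_) (sym (roots zero)) ⟩
        q + eval c (r zero)     ≡⟨ sym (c≡ (r (suc i))) ⟩
        eval c (r (suc i))      ≡⟨ roots (suc i) ⟩
        0#                      ∎
        where q = (r (suc i) - r zero) * eval d (r (suc i))
      r₁≢r₀ : r (suc i) - r zero ≢ 0#
      r₁≢r₀ diff≡0 with r-inj (difference-zero _ _ diff≡0)
      ... | ()
    d≡0 : ∀ y → eval d y ≡ 0#
    d≡0 = root-bound d (λ i → r (suc i)) (λ e → FinP.suc-injective (r-inj e)) d-root

  vanishes : ∀ {m f} → PolyFn m f → (r : Fin m → Carrier) →
             (∀ {i j} → r i ≡ r j → i ≡ j) → (∀ i → f (r i) ≡ 0#) → ∀ x → f x ≡ 0#
  vanishes (c , f≡c) r r-inj roots x =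
    trans (f≡c x) (root-bound c r r-inj (λ i → trans (sym (f≡c (r i))) (roots i)) x)

  poly-ext : ∀ {m f g} → (∀ x → f x ≡ g x) → PolyFn m f → PolyFn m g
  poly-ext f≡g (c , f≡c) = c , λ x → trans (sym (f≡g x)) (f≡c x)

  eval-zeros : ∀ m x → eval (replicate m 0#) x ≡ 0#
  eval-zeros zero    x = refl
  eval-zeros (suc m) x = begin
    0# + x * eval (replicate m 0#) x  ≡⟨ cong (λ z → 0# + x * z) (eval-zeros m x) ⟩
    0# + x * 0#                       ≡⟨ solve 1 (λ x → con (ℤ.+ 0) :+ x :* con (ℤ.+ 0) := con (ℤ.+ 0)) refl x ⟩
    0#                                ∎

  poly-const : ∀ {m} → 0 ℕ.< m → ∀ a → PolyFn m (λ _ → a)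
  poly-const {suc m} _ a = (a ∷ replicate m 0#) , λ x → begin
    a                                 ≡⟨ solve 2 (λ a x → a := a :+ x :* con (ℤ.+ 0)) refl a x ⟩
    a + x * 0#                        ≡⟨ cong (λ z → a + x * z) (sym (eval-zeros m x)) ⟩
    a + x * eval (replicate m 0#) x   ∎

  padV : ∀ {m} → Vec Carrier m → Vec Carrier (suc m)
  padV []       = 0# ∷ []
  padV (c ∷ cs) = c ∷ padV cs

  eval-padV : ∀ {m} (c : Vec Carrier m) x → eval (padV c) x ≡ eval c x
  eval-padV []       x = eval-zeros 1 x
  eval-padV (c ∷ cs) x = cong (λ z → c + x * z) (eval-padV cs x)

  poly-pad : ∀ {m f} → PolyFn m f → PolyFn (suc m) f
  poly-pad (c , f≡c) = padV c , λ x → trans (f≡c x) (sym (eval-padV c x))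

  poly-+ : ∀ {m f g} → PolyFn m f → PolyFn m g → PolyFn m (λ x → f x + g x)
  poly-+ ([] , f≡) ([] , g≡) = [] , λ x → begin
    _ + _    ≡⟨ cong₂ _+_ (f≡ x) (g≡ x) ⟩
    0# + 0#  ≡⟨ +-identityˡ 0# ⟩
    0#       ∎
  poly-+ {f = f} {g} ((c ∷ cs) , f≡) ((d ∷ ds) , g≡) with poly-+ (cs , λ _ → refl) (ds , λ _ → refl)
  ... | es , es≡ = (c + d) ∷ es , λ x → begin
    f x + g x
      ≡⟨ cong₂ _+_ (f≡ x) (g≡ x) ⟩
    (c + x * eval cs x) + (d + x * eval ds x)
      ≡⟨ solve 5 (λ c d x A B → (c :+ x :* A) :+ (d :+ x :* B) := (c :+ d) :+ x :* (A :+ B))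
           refl c d x (eval cs x) (eval ds x) ⟩
    (c + d) + x * (eval cs x + eval ds x)
      ≡⟨ cong (λ z → (c + d) + x * z) (es≡ x) ⟩
    (c + d) + x * eval es x ∎

  poly-scale : ∀ {m f} s → PolyFn m f → PolyFn m (λ x → s * f x)
  poly-scale s ([] , f≡) = [] , λ x → trans (cong (s *_) (f≡ x)) (zeroʳ s)
  poly-scale {f = f} s ((c ∷ cs) , f≡) with poly-scale s (cs , λ _ → refl)
  ... | ds , ds≡ = (s * c) ∷ ds , λ x → begin
    s * f x                      ≡⟨ cong (s *_) (f≡ x) ⟩
    s * (c + x * eval cs x)      ≡⟨ solve 4 (λ s c x A → s :* (c :+ x :* A) := s :* c :+ x :* (s :* A)) refl s c x (eval cs x) ⟩
    s * c + x * (s * eval cs x)  ≡⟨ cong (λ z → s * c + x * z) (ds≡ x) ⟩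
    s * c + x * eval ds x        ∎

  poly-- : ∀ {m f g} → PolyFn m f → PolyFn m g → PolyFn m (λ x → f x - g x)
  poly-- {f = f} {g} P Q = poly-ext (λ x → cong (f x +_) (-1*x≈-x (g x)))
    (poly-+ P (poly-scale (- 1#) Q))

  poly-X : ∀ {m f} → PolyFn m f → PolyFn (suc m) (λ x → x * f x)
  poly-X (c , f≡c) = (0# ∷ c) , λ x → trans (cong (x *_) (f≡c x)) (sym (+-identityˡ _))

  poly-linear : ∀ {m f} s → PolyFn m f → PolyFn (suc m) (λ x → (x + s) * f x)
  poly-linear {f = f} s P =
    poly-ext (λ x → sym (distribʳ (f x) x s)) (poly-+ (poly-X P) (poly-pad (poly-scale s P)))

  poly-pow : ∀ k → PolyFn (suc k) (λ x → x ^ k)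
  poly-pow zero    = poly-const (ℕ.s≤s ℕ.z≤n) 1#
  poly-pow (suc k) = poly-X (poly-pow k)

  Monic : ℕ → (Carrier → Carrier) → Set
  Monic k f = Σ (Vec Carrier k) λ c → ∀ x → f x ≡ x ^ k + eval c x

  monic⇒poly : ∀ {k f} → Monic k f → PolyFn (suc k) f
  monic⇒poly {k} (c , f≡) = poly-ext (λ x → sym (f≡ x)) (poly-+ (poly-pow k) (poly-pad (c , λ _ → refl)))

  monic-linear : ∀ {k f} s → Monic k f → Monic (suc k) (λ x → (x + s) * f x)
  monic-linear {k} {f} s (c , f≡) with poly-+ (poly-scale s (poly-pow k)) (poly-linear s (c , λ _ → refl))
  ... | d , d≡ = d , λ x → begin
    (x + s) * f x
      ≡⟨ cong ((x + s) *_) (f≡ x) ⟩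
    (x + s) * (x ^ k + eval c x)
      ≡⟨ solve 4 (λ x s P C → (x :+ s) :* (P :+ C) := x :* P :+ (s :* P :+ (x :+ s) :* C)) refl x s (x ^ k) (eval c x) ⟩
    x * x ^ k + (s * x ^ k + (x + s) * eval c x)
      ≡⟨ cong (x * x ^ k +_) (d≡ x) ⟩
    x * x ^ k + eval d x ∎

  monic-difference : ∀ {k f g} → Monic k f → Monic k g → PolyFn k (λ x → f x - g x)
  monic-difference {k} {f} {g} (c , f≡) (d , g≡) = poly-ext cancel-leading (poly-- (c , λ _ → refl) (d , λ _ → refl))
    where
    cancel-leading : ∀ x → eval c x - eval d x ≡ f x - g x
    cancel-leading x = trans (solve 3 (λ P C D → C :- D := (P :+ C) :- (P :+ D)) refl (x ^ k) (eval c x) (eval d x))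
                             (sym (cong₂ _-_ (f≡ x) (g≡ x)))

  ∏-monic : ∀ k (c : ℕ → Carrier) → Monic k (λ t → ∏ k (λ j → t + c j))
  ∏-monic zero    c = [] , λ _ → sym (+-identityʳ 1#)
  ∏-monic (suc k) c = monic-linear (c k) (∏-monic k c)

module FiniteTotals {B : Set} {op : B → B → B} {ε : B} (isCM : IsCommutativeMonoid _≡_ op ε)
    {A : Set} {q : ℕ} (enumeration : Fin q ↔ A) where
  M : CommutativeMonoid 0ℓ 0ℓ
  M = record { isCommutativeMonoid = isCM }
  open CommutativeMonoid M using (_∙_; rawMonoid)
  open CommutativeMonoidSum M using (sum; sum-permute; sum-remove; sum-cong-≗; sum-replicate; ∑-distrib-+)
  open RawMonoidDefinitions rawMonoid public using () renaming (_×_ to _times_)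
  open Inverse enumeration using (strictlyInverseˡ; strictlyInverseʳ) renaming (to to enum; from to index)
  open ≡-Reasoning

  total : (A → B) → B
  total g = sum (λ i → g (enum i))

  total-bijection : (σ τ : A → A) → (∀ x → σ (τ x) ≡ x) → (∀ x → τ (σ x) ≡ x) →
                    ∀ g → total (λ x → g (σ x)) ≡ total g
  total-bijection σ τ στ τσ g = sym (begin
    total g                                        ≡⟨ sum-permute (λ i → g (enum i)) π ⟩
    sum {q} (λ i → g (enum (index (σ (enum i)))))  ≡⟨ sum-cong-≗ (λ i → cong g (strictlyInverseˡ (σ (enum i)))) ⟩
    total (λ x → g (σ x))                          ∎)
    where
    π : Permutation q q
    π = mk↔ₛ′ (λ i → index (σ (enum i))) (λ i → index (τ (enum i)))
          (λ i → trans (cong (λ z → index (σ z)) (strictlyInverseˡ _)) (trans (cong index (στ _)) (strictlyInverseʳ i)))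
          (λ i → trans (cong (λ z → index (τ z)) (strictlyInverseˡ _)) (trans (cong index (τσ _)) (strictlyInverseʳ i)))

  total-cong : ∀ {g h} → (∀ x → g x ≡ h x) → total g ≡ total h
  total-cong g≡h = sum-cong-≗ (λ i → g≡h (enum i))

  total-closed : (P : B → Set) → P ε → (∀ {a b} → P a → P b → P (a ∙ b)) →
                 ∀ g → (∀ x → P (g x)) → P (total g)
  total-closed P Pε P∙ g Pg = sum-closed (λ i → g (enum i)) (λ i → Pg (enum i))
    where
    sum-closed : ∀ {n} (t : Fin n → B) → (∀ i → P (t i)) → P (sum t)
    sum-closed {zero}  t Pt = Pε
    sum-closed {suc n} t Pt = P∙ (Pt zero) (sum-closed (λ i → t (suc i)) (λ i → Pt (suc i)))

  total-∙ : ∀ g h → total (λ x → g x ∙ h x) ≡ total g ∙ total h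
  total-∙ g h = ∑-distrib-+ (λ i → g (enum i)) (λ i → h (enum i))

  total-const : ∀ a → total (λ _ → a) ≡ q times a
  total-const a = sum-replicate q

  total-except : ∀ {q′} → q ≡ suc q′ → ∀ x₀ g a → (∀ x → x ≢ x₀ → g x ≡ a) →
                 total g ≡ g x₀ ∙ (q′ times a)
  total-except {q′} refl x₀ g a g≡a = begin
    total g                                            ≡⟨ sum-remove {i = index x₀} (λ i → g (enum i)) ⟩
    g (enum (index x₀)) ∙ sum (removeAt (λ i → g (enum i)) (index x₀))
      ≡⟨ cong₂ _∙_ (cong g (strictlyInverseˡ x₀)) (sum-cong-≗ away) ⟩
    g x₀ ∙ sum {q′} (λ _ → a)                          ≡⟨ cong (g x₀ ∙_) (sum-replicate q′) ⟩
    g x₀ ∙ (q′ times a)                                ∎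
    where
    away : ∀ k → removeAt (λ i → g (enum i)) (index x₀) k ≡ a
    away k = g≡a _ (λ enum≡x₀ → FinP.punchInᵢ≢i (index x₀) k
               (trans (sym (strictlyInverseʳ _)) (cong index enum≡x₀)))

module FiniteField (F : Field) {q : ℕ} (enumeration : Fin q ↔ Field.Carrier F) where
  open FieldAlgebra F
  open IsCommutativeRing isCommutativeRing using (+-isCommutativeMonoid; *-isCommutativeMonoid)
  open ≡-Reasoning
  module Additive       = FiniteTotals +-isCommutativeMonoid enumeration
  module Multiplicative = FiniteTotals *-isCommutativeMonoid enumeration

  times≡· : ∀ n a → n Additive.times a ≡ n · a
  times≡· zero    a = refl
  times≡· (suc n) a = cong (a +_) (times≡· n a)

  times≡^ : ∀ n a → n Multiplicative.times a ≡ a ^ n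
  times≡^ zero    a = refl
  times≡^ (suc n) a = cong (a *_) (times≡^ n a)

  -- compare the total of all x with the total of all x + 1
  characteristic : q · 1# ≡ 0#
  characteristic = +-cancelˡ S (begin
    S + q · 1#                             ≡⟨ cong (S +_) (sym (times≡· q 1#)) ⟩
    S + q Additive.times 1#                ≡⟨ cong (S +_) (sym (Additive.total-const 1#)) ⟩
    S + Additive.total (λ _ → 1#)          ≡⟨ sym (Additive.total-∙ (λ x → x) (λ _ → 1#)) ⟩
    Additive.total (λ x → x + 1#)          ≡⟨ Additive.total-bijection (_+ 1#) (_- 1#) -1+1 +1-1 (λ x → x) ⟩
    S                                      ≡⟨ sym (+-identityʳ S) ⟩
    S + 0#                                 ∎)
    where
    S = Additive.total (λ x → x)
    -1+1 : ∀ x → (x - 1#) + 1# ≡ x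
    -1+1 x = solve 2 (λ x o → (x :- o) :+ o := x) refl x 1#
    +1-1 : ∀ x → (x + 1#) - 1# ≡ x
    +1-1 x = solve 2 (λ x o → (x :+ o) :- o := x) refl x 1#

  -- ν replaces 0 by 1; multiplication by u ≠ 0 permutes F, and
  -- ν (u * x) = (u, or 1 if x = 0) * ν x, so comparing the products of ν over
  -- F before and after the permutation gives  u ^ (q-1) = 1
  ν : Carrier → Carrier
  ν x with x ≟ 0#
  ... | yes _ = 1#
  ... | no  _ = x

  ν-nonzero : ∀ x → ν x ≢ 0#
  ν-nonzero x with x ≟ 0#
  ... | yes _   = λ 1≡0 → 0≢1 (sym 1≡0)
  ... | no  x≢0 = x≢0

  factor : Carrier → Carrier → Carrier
  factor u x with x ≟ 0#
  ... | yes _ = 1#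
  ... | no  _ = u

  ν-scale : ∀ u → u ≢ 0# → ∀ x → ν (u * x) ≡ factor u x * ν x
  ν-scale u u≢0 x with x ≟ 0# | (u * x) ≟ 0#
  ... | yes _   | yes _    = sym (*-identityˡ 1#)
  ... | yes x≡0 | no ux≢0  = ⊥-elim (ux≢0 (trans (cong (u *_) x≡0) (zeroʳ u)))
  ... | no x≢0  | yes ux≡0 = ⊥-elim (nonzero-product u≢0 x≢0 ux≡0)
  ... | no _    | no _     = refl

  factor-away : ∀ u x → x ≢ 0# → factor u x ≡ u
  factor-away u x x≢0 with x ≟ 0#
  ... | yes x≡0 = ⊥-elim (x≢0 x≡0)
  ... | no _    = refl

  factor-zero : ∀ u → factor u 0# ≡ 1#
  factor-zero u with 0# ≟ 0#
  ... | yes _   = refl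
  ... | no 0≢0  = ⊥-elim (0≢0 refl)

  fermat : ∀ {q′} → q ≡ suc q′ → ∀ u → u ≢ 0# → u ^ q′ ≡ 1#
  fermat {q′} q≡1+q′ u u≢0 with inverse u u≢0
  ... | v , uv≡1 = *-cancelˡ G≢0 (begin
    G * u ^ q′                                      ≡⟨ *-comm G _ ⟩
    u ^ q′ * G                                      ≡⟨ cong (_* G) (sym total-factor) ⟩
    Multiplicative.total (factor u) * G             ≡⟨ sym (Multiplicative.total-∙ (factor u) ν) ⟩
    Multiplicative.total (λ x → factor u x * ν x)   ≡⟨ sym (Multiplicative.total-cong (ν-scale u u≢0)) ⟩
    Multiplicative.total (λ x → ν (u * x))
      ≡⟨ Multiplicative.total-bijection (u *_) (v *_) (cancel u v uv≡1) (cancel v u vu≡1) ν ⟩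
    G                                               ≡⟨ sym (*-identityʳ G) ⟩
    G * 1#                                          ∎)
    where
    G = Multiplicative.total ν
    vu≡1 : v * u ≡ 1#
    vu≡1 = trans (*-comm v u) uv≡1
    cancel : ∀ a b → a * b ≡ 1# → ∀ x → a * (b * x) ≡ x
    cancel a b ab≡1 x = trans (sym (*-assoc a b x)) (trans (cong (_* x) ab≡1) (*-identityˡ x))
    G≢0 : G ≢ 0#
    G≢0 = Multiplicative.total-closed (λ x → x ≢ 0#) (λ 1≡0 → 0≢1 (sym 1≡0)) nonzero-product ν ν-nonzero
    total-factor : Multiplicative.total (factor u) ≡ u ^ q′
    total-factor = begin
      Multiplicative.total (factor u)            ≡⟨ Multiplicative.total-except q≡1+q′ 0# (factor u) u (factor-away u) ⟩
      factor u 0# * (q′ Multiplicative.times u)  ≡⟨ cong₂ _*_ (factor-zero u) (times≡^ q′ u) ⟩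
      1# * u ^ q′                                ≡⟨ *-identityˡ _ ⟩
      u ^ q′                                     ∎

module PrimeSubfield (F : Field) (p : ℕ) (p-prime : Prime p)
    (p·1≡0 : Field._·_ F p (Field.1# F) ≡ Field.0# F) where
  open FieldAlgebra F
  open ≡-Reasoning
  instance
    p-nonZero : ℕ.NonZero p
    p-nonZero = prime⇒nonZero p-prime

  InFp : Carrier → Set
  InFp t = Σ ℕ λ n → t ≡ n · 1#

  vanishing-multiple : ∀ k n → n · 1# ≡ 0# → (k ℕ.* n) · 1# ≡ 0#
  vanishing-multiple k n n·1≡0 = trans (·-* k n) (trans (cong ((k · 1#) *_) n·1≡0) (zeroʳ _))

  mod-p : ∀ n → n · 1# ≡ (n % p) · 1#
  mod-p n = begin
    n · 1#                                  ≡⟨ cong (_· 1#) (m≡m%n+[m/n]*n n p) ⟩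
    (n % p ℕ.+ (n / p) ℕ.* p) · 1#          ≡⟨ ·-+ (n % p) _ 1# ⟩
    (n % p) · 1# + ((n / p) ℕ.* p) · 1#     ≡⟨ cong ((n % p) · 1# +_) (vanishing-multiple (n / p) p p·1≡0) ⟩
    (n % p) · 1# + 0#                       ≡⟨ +-identityʳ _ ⟩
    (n % p) · 1#                            ∎

  line-below-p : ∀ x a y → (Σ ℕ λ n → y ≡ x + n · a) → Σ ℕ λ j → j ℕ.< p × y ≡ x + j · a
  line-below-p x a y (n , y≡x+n·a) = n % p , m%n<n n p , trans y≡x+n·a (cong (x +_) n·a≡[n%p]·a)
    where
    n·a≡[n%p]·a : n · a ≡ (n % p) · a
    n·a≡[n%p]·a = trans (·-scales n a) (trans (cong (_* a) (mod-p n)) (sym (·-scales (n % p) a)))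

  successor-vanishing : ∀ a b → suc a ≡ b → a · 1# ≡ 0# → b · 1# ≡ 0# → ⊥
  successor-vanishing a b 1+a≡b a·1≡0 b·1≡0 = 0≢1 (begin
    0#            ≡⟨ sym b·1≡0 ⟩
    b · 1#        ≡⟨ cong (_· 1#) (sym 1+a≡b) ⟩
    1# + a · 1#   ≡⟨ cong (1# +_) a·1≡0 ⟩
    1# + 0#       ≡⟨ +-identityʳ 1# ⟩
    1#            ∎)

  -- 0 < m < p is coprime to p, and a Bézout identity for m and p relates
  -- two vanishing multiples as above
  below-p-nonzero : ∀ m → 0 ℕ.< m → m ℕ.< p → m · 1# ≢ 0#
  below-p-nonzero m@(suc _) _ m<p m·1≡0 with coprime-Bézout (prime⇒coprime p-prime m<p)
  ... | Bézout.+- x y 1+ym≡xp = successor-vanishing (y ℕ.* m) (x ℕ.* p) 1+ym≡xp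
          (vanishing-multiple y m m·1≡0) (vanishing-multiple x p p·1≡0)
  ... | Bézout.-+ x y 1+xp≡ym = successor-vanishing (x ℕ.* p) (y ℕ.* m) 1+xp≡ym
          (vanishing-multiple x p p·1≡0) (vanishing-multiple y m m·1≡0)

  -- j ≤ k < p with j · 1 = k · 1: the difference k - j vanishes, so it is 0
  below-p-injective≤ : ∀ {j k} → j ℕ.≤ k → k ℕ.< p → j · 1# ≡ k · 1# → j ≡ k
  below-p-injective≤ {j} {k} j≤k k<p j≡k with k ℕ.∸ j in d≡k-j
  ... | zero  = ℕP.≤-antisym j≤k (ℕP.m∸n≡0⇒m≤n d≡k-j)
  ... | suc d = ⊥-elim (below-p-nonzero (suc d) (ℕ.s≤s ℕ.z≤n) 1+d<p (+-cancelˡ (j · 1#) (begin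
      j · 1# + suc d · 1#          ≡⟨ sym (·-+ j (suc d) 1#) ⟩
      (j ℕ.+ suc d) · 1#           ≡⟨ cong (λ z → (j ℕ.+ z) · 1#) (sym d≡k-j) ⟩
      (j ℕ.+ (k ℕ.∸ j)) · 1#       ≡⟨ cong (_· 1#) (ℕP.m+[n∸m]≡n j≤k) ⟩
      k · 1#                       ≡⟨ sym j≡k ⟩
      j · 1#                       ≡⟨ sym (+-identityʳ _) ⟩
      j · 1# + 0#                  ∎)))
    where
    1+d<p : suc d ℕ.< p
    1+d<p = ℕP.≤-<-trans (subst (ℕ._≤ k) d≡k-j (ℕP.m∸n≤m k j)) k<p

  below-p-injective : ∀ {j k} → j ℕ.< p → k ℕ.< p → j · 1# ≡ k · 1# → j ≡ k
  below-p-injective {j} {k} j<p k<p j≡k with ℕP.≤-total j k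
  ... | inj₁ j≤k = below-p-injective≤ j≤k k<p j≡k
  ... | inj₂ k≤j = sym (below-p-injective≤ k≤j j<p (sym j≡k))

  -- the prime field is closed under negation (-(n · 1) = ((p-1) n) · 1,
  -- as n + (p-1) n = p n) and addition
  InFp-neg : ∀ {t} → InFp t → InFp (- t)
  InFp-neg {t} (n , t≡n·1) = ℕ.pred p ℕ.* n , sym (negation-unique t r t+r≡0)
    where
    r = (ℕ.pred p ℕ.* n) · 1#
    t+r≡0 : t + r ≡ 0#
    t+r≡0 = begin
      t + r                               ≡⟨ cong (_+ r) t≡n·1 ⟩
      n · 1# + r                          ≡⟨ sym (·-+ n _ 1#) ⟩
      (n ℕ.+ ℕ.pred p ℕ.* n) · 1#        ≡⟨ cong (λ k → (k ℕ.* n) · 1#) (ℕP.suc-pred p) ⟩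
      (p ℕ.* n) · 1#                      ≡⟨ trans (cong (_· 1#) (ℕP.*-comm p n)) (vanishing-multiple n p p·1≡0) ⟩
      0#                                  ∎

  InFp-+ : ∀ {s t} → InFp s → InFp t → InFp (s + t)
  InFp-+ (m , s≡m·1) (n , t≡n·1) = m ℕ.+ n , trans (cong₂ _+_ s≡m·1 t≡n·1) (sym (·-+ m n 1#))

  InFp-- : ∀ {s t} → InFp s → InFp t → InFp (s - t)
  InFp-- s∈ t∈ = InFp-+ s∈ (InFp-neg t∈)

module InversionMap (F : Field) (inv : Field.Carrier F → Field.Carrier F)
    (inv-0 : inv (Field.0# F) ≡ Field.0# F)
    (inv-r : ∀ u → u ≢ Field.0# F → Field._*_ F u (inv u) ≡ Field.1# F) where
  open FieldAlgebra F
  open ≡-Reasoning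

  inv-nonzero : ∀ u → u ≢ 0# → inv u ≢ 0#
  inv-nonzero u u≢0 inv≡0 = 0≢1 (trans (sym (zeroʳ u)) (trans (cong (u *_) (sym inv≡0)) (inv-r u u≢0)))

  inv-* : ∀ u v → inv (u * v) ≡ inv u * inv v
  inv-* u v with u ≟ 0# | v ≟ 0#
  ... | yes refl | _        = trans (cong inv (zeroˡ v)) (trans inv-0 (sym (trans (cong (_* inv v) inv-0) (zeroˡ _))))
  ... | no _     | yes refl = trans (cong inv (zeroʳ u)) (trans inv-0 (sym (trans (cong (inv u *_) inv-0) (zeroʳ _))))
  ... | no u≢0   | no v≢0   = inverse-unique (inv-r (u * v) (nonzero-product u≢0 v≢0)) (begin
    (u * v) * (inv u * inv v)   ≡⟨ solve 4 (λ u v a b → (u :* v) :* (a :* b) := (u :* a) :* (v :* b)) refl u v (inv u) (inv v) ⟩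
    (u * inv u) * (v * inv v)   ≡⟨ cong₂ _*_ (inv-r u u≢0) (inv-r v v≢0) ⟩
    1# * 1#                     ≡⟨ *-identityˡ 1# ⟩
    1#                          ∎)

  inv-neg : ∀ u → inv (- u) ≡ - inv u
  inv-neg u with u ≟ 0#
  ... | yes refl = trans (cong inv -0#≈0#) (trans inv-0 (sym (trans (cong -_ inv-0) -0#≈0#)))
  ... | no u≢0   = inverse-unique (inv-r (- u) -u≢0) (begin
    - u * - inv u  ≡⟨ solve 2 (λ u v → (:- u) :* (:- v) := u :* v) refl u (inv u) ⟩
    u * inv u      ≡⟨ inv-r u u≢0 ⟩
    1#             ∎)
    where
    -u≢0 : - u ≢ 0#
    -u≢0 -u≡0 = u≢0 (trans (sym (-‿involutive u)) (trans (cong -_ -u≡0) -0#≈0#))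

-- With  P(t) = ∏_{j<p} (t + j)  and its derivative  E(t) = ∑_j ∏_{i≠j} (t + i)
-- one has  T · P = E  off 𝔽ₚ (logarithmic derivative). E has degree < p and is
-- constant on each translate t + 𝔽ₚ, hence constant off 𝔽ₚ, with value
-- E(0) = (p-1)! ≠ 0; T vanishes on 𝔽ₚ; and P vanishes exactly on 𝔽ₚ and is
-- additive. Together: T(t) = T(s) forces s - t ∈ 𝔽ₚ.
module ReciprocalSum (F : Field) (p : ℕ) (p-prime : Prime p) (2<p : 2 ℕ.< p)
    (p·1≡0 : Field._·_ F p (Field.1# F) ≡ Field.0# F)
    (inv : Field.Carrier F → Field.Carrier F) (inv-0 : inv (Field.0# F) ≡ Field.0# F)
    (inv-r : ∀ u → u ≢ Field.0# F → Field._*_ F u (inv u) ≡ Field.1# F) where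
  open FieldAlgebra F
  open RangeSumsAndProducts F
  open Polynomials F
  open PrimeSubfield F p p-prime p·1≡0
  open InversionMap F inv inv-0 inv-r
  open ≡-Reasoning

  0<p : 0 ℕ.< p
  0<p = ℕP.<-trans (ℕ.s≤s ℕ.z≤n) 2<p

  P : Carrier → Carrier
  P t = ∏ p (λ j → t + j · 1#)

  T : Carrier → Carrier
  T t = ∑ p (λ j → inv (t + j · 1#))

  -- E k t = ∑_{j<k} ∏_{i<k, i≠j} (t + i), by the product rule
  E : ℕ → Carrier → Carrier
  E zero    t = 0#
  E (suc k) t = ∏ k (λ j → t + j · 1#) + (t + k · 1#) * E k t

  -- translation by 1 permutes the terms t + j (j < p), since p · 1 = 0
  translate-1 : ∀ t j → (t + 1#) + j · 1# ≡ t + suc j · 1#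
  translate-1 t j = +-assoc t 1# (j · 1#)

  translate-suc : ∀ t n → t + suc n · 1# ≡ (t + n · 1#) + 1#
  translate-suc t n = trans (cong (t +_) (+-comm 1# (n · 1#))) (sym (+-assoc t (n · 1#) 1#))

  wrap-around : ∀ t → t + p · 1# ≡ t + 0 · 1#
  wrap-around t = cong (t +_) p·1≡0

  P-periodic : ∀ t n → P (t + n · 1#) ≡ P t
  P-periodic t zero    = cong P (+-identityʳ t)
  P-periodic t (suc n) = begin
    P (t + suc n · 1#)         ≡⟨ cong P (translate-suc t n) ⟩
    P ((t + n · 1#) + 1#)      ≡⟨ ∏-cong p (λ j _ → translate-1 _ j) ⟩
    ∏ p (λ j → (t + n · 1#) + suc j · 1#)  ≡⟨ ∏-cyclic p (λ j → (t + n · 1#) + j · 1#) (wrap-around _) ⟩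
    P (t + n · 1#)             ≡⟨ P-periodic t n ⟩
    P t                        ∎

  T-periodic : ∀ t n → T (t + n · 1#) ≡ T t
  T-periodic t zero    = cong T (+-identityʳ t)
  T-periodic t (suc n) = begin
    T (t + suc n · 1#)         ≡⟨ cong T (translate-suc t n) ⟩
    T ((t + n · 1#) + 1#)      ≡⟨ ∑-cong p (λ j _ → cong inv (translate-1 _ j)) ⟩
    ∑ p (λ j → inv ((t + n · 1#) + suc j · 1#))
      ≡⟨ ∑-cyclic p (λ j → inv ((t + n · 1#) + j · 1#)) (cong inv (wrap-around _)) ⟩
    T (t + n · 1#)             ≡⟨ T-periodic t n ⟩
    T t                        ∎

  P-zero : P 0# ≡ 0#
  P-zero = ∏-zero p _ 0 0<p (+-identityʳ 0#)

  P-root : ∀ {t} → InFp t → P t ≡ 0#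
  P-root {t} (n , t≡n·1) = begin
    P t                ≡⟨ cong P (trans t≡n·1 (sym (+-identityˡ _))) ⟩
    P (0# + n · 1#)    ≡⟨ P-periodic 0# n ⟩
    P 0#               ≡⟨ P-zero ⟩
    0#                 ∎

  P-root⁻¹ : ∀ {t} → P t ≡ 0# → InFp t
  P-root⁻¹ {t} Pt≡0 with ∏-zero⁻¹ p _ Pt≡0
  ... | j , _ , t+j≡0 = subst InFp (sym (negation-unique (j · 1#) t (trans (+-comm _ t) t+j≡0)))
                              (InFp-neg (j , refl))

  E-poly : ∀ k → PolyFn k (E k)
  E-poly zero    = [] , λ _ → refl
  E-poly (suc k) = poly-+ (monic⇒poly (∏-monic k (λ j → j · 1#))) (poly-linear (k · 1#) (E-poly k))

  log-derivative : ∀ k t → (∀ j → j ℕ.< k → t + j · 1# ≢ 0#) →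
                   ∑ k (λ j → inv (t + j · 1#)) * ∏ k (λ j → t + j · 1#) ≡ E k t
  log-derivative zero    t _          = zeroˡ 1#
  log-derivative (suc k) t factors≢0 = begin
    (inv L + S) * (L * Q)
      ≡⟨ solve 4 (λ I L S Q → (I :+ S) :* (L :* Q) := (L :* I) :* Q :+ L :* (S :* Q)) refl (inv L) L S Q ⟩
    (L * inv L) * Q + L * (S * Q)    ≡⟨ cong₂ (λ u v → u * Q + L * v) (inv-r L (factors≢0 k ℕP.≤-refl))
                                          (log-derivative k t (λ j j<k → factors≢0 j (ℕP.m≤n⇒m≤1+n j<k))) ⟩
    1# * Q + L * E k t               ≡⟨ cong (_+ L * E k t) (*-identityˡ Q) ⟩
    Q + L * E k t                    ∎
    where
    L = t + k · 1#
    S = ∑ k (λ j → inv (t + j · 1#))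
    Q = ∏ k (λ j → t + j · 1#)

  TP≡E : ∀ t → P t ≢ 0# → T t * P t ≡ E p t
  TP≡E t Pt≢0 = log-derivative p t (λ j j<p t+j≡0 → Pt≢0 (∏-zero p _ j j<p t+j≡0))

  -- off 𝔽ₚ, E is constant: E - E(t) has degree < p and vanishes on t + 𝔽ₚ,
  -- where E = T · P is constant by periodicity
  E-constant : ∀ t → P t ≢ 0# → E p t ≡ E p 0#
  E-constant t Pt≢0 = sym (difference-zero _ _
      (vanishes (poly-- (E-poly p) (poly-const 0<p (E p t))) translates translates-injective on-translates 0#))
    where
    translates : Fin p → Carrier
    translates i = t + toℕ i · 1#
    translates-injective : ∀ {i j} → translates i ≡ translates j → i ≡ j
    translates-injective {i} {j} eq = FinP.toℕ-injective
      (below-p-injective (FinP.toℕ<n i) (FinP.toℕ<n j) (+-cancelˡ t eq))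
    on-translates : ∀ i → E p (translates i) - E p t ≡ 0#
    on-translates i = difference-self (begin
      E p (t + n · 1#)                 ≡⟨ sym (TP≡E (t + n · 1#) (λ P≡0 → Pt≢0 (trans (sym (P-periodic t n)) P≡0))) ⟩
      T (t + n · 1#) * P (t + n · 1#)  ≡⟨ cong₂ _*_ (T-periodic t n) (P-periodic t n) ⟩
      T t * P t                        ≡⟨ TP≡E t Pt≢0 ⟩
      E p t                            ∎)
      where n = toℕ i

  -- E k 0 = (k-1)! for k ≥ 1, which is nonzero for k ≤ p
  E₀ : Carrier
  E₀ = E p 0#

  E-at-0-nonzero : ∀ k → 0 ℕ.< k → k ℕ.≤ p → E k 0# ≢ 0#
  E-at-0-nonzero (suc zero)    _ _   E≡0 = 0≢1 (sym (begin
    1#                        ≡⟨ solve 1 (λ o → o := o :+ (con (ℤ.+ 0) :+ con (ℤ.+ 0)) :* con (ℤ.+ 0)) refl 1# ⟩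
    1# + (0# + 0#) * 0#       ≡⟨ E≡0 ⟩
    0#                        ∎))
  E-at-0-nonzero (suc (suc k)) _ k+2≤p E≡0 =
    nonzero-product 0+k+1≢0 (E-at-0-nonzero (suc k) (ℕ.s≤s ℕ.z≤n) (ℕP.<⇒≤ k+2≤p)) (begin
      R                       ≡⟨ sym (+-identityˡ R) ⟩
      0# + R                  ≡⟨ cong (_+ R) (sym (∏-zero (suc k) (λ j → 0# + j · 1#) 0 (ℕ.s≤s ℕ.z≤n) (+-identityʳ 0#))) ⟩
      E (suc (suc k)) 0#      ≡⟨ E≡0 ⟩
      0#                      ∎)
    where
    R = (0# + suc k · 1#) * E (suc k) 0#
    0+k+1≢0 : 0# + suc k · 1# ≢ 0#
    0+k+1≢0 eq = below-p-nonzero (suc k) (ℕ.s≤s ℕ.z≤n) k+2≤p (trans (sym (+-identityˡ _)) eq)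

  E₀-nonzero : E₀ ≢ 0#
  E₀-nonzero = E-at-0-nonzero p 0<p ℕP.≤-refl

  TP≡E₀ : ∀ t → P t ≢ 0# → T t * P t ≡ E₀
  TP≡E₀ t Pt≢0 = trans (TP≡E t Pt≢0) (E-constant t Pt≢0)

  -- T(0) = -T(0): reversing the range of summation turns the term of j into
  -- inv (-(j+1)) = -inv (j+1); as 2 ≠ 0 in F, T(0) = 0
  T-zero : T 0# ≡ 0#
  T-zero = zero-product 2T≡0 (below-p-nonzero 2 (ℕ.s≤s ℕ.z≤n) 2<p)
    where
    g : ℕ → Carrier
    g j = inv (0# + j · 1#)
    reflect : ∀ j → j ℕ.< p → g (p ℕ.∸ suc j) ≡ - g (suc j)
    reflect j j<p = begin
      inv (0# + (p ℕ.∸ suc j) · 1#)    ≡⟨ cong inv (trans (+-identityˡ _) (negation-unique _ _ p-j+j≡0)) ⟩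
      inv (- (suc j · 1#))            ≡⟨ inv-neg _ ⟩
      - inv (suc j · 1#)              ≡⟨ cong (λ z → - inv z) (sym (+-identityˡ _)) ⟩
      - inv (0# + suc j · 1#)         ∎
      where
      p-j+j≡0 : suc j · 1# + (p ℕ.∸ suc j) · 1# ≡ 0#
      p-j+j≡0 = trans (sym (·-+ (suc j) _ 1#)) (trans (cong (_· 1#) (ℕP.m+[n∸m]≡n j<p)) p·1≡0)
    T≡-T : T 0# ≡ - T 0#
    T≡-T = begin
      T 0#                             ≡⟨ sym (∑-reverse p g) ⟩
      ∑ p (λ j → g (p ℕ.∸ suc j))      ≡⟨ ∑-cong p reflect ⟩
      ∑ p (λ j → - g (suc j))          ≡⟨ ∑-neg p (λ j → g (suc j)) ⟩
      - ∑ p (λ j → g (suc j))          ≡⟨ cong -_ (∑-cyclic p g (cong inv (wrap-around 0#))) ⟩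
      - T 0#                           ∎
    2T≡0 : 2 · 1# * T 0# ≡ 0#
    2T≡0 = begin
      2 · 1# * T 0#     ≡⟨ solve 1 (λ x → con (ℤ.+ 2) :* x := x :+ x) refl (T 0#) ⟩
      T 0# + T 0#       ≡⟨ cong (T 0# +_) T≡-T ⟩
      T 0# - T 0#       ≡⟨ -‿inverseʳ (T 0#) ⟩
      0#                ∎

  T-on-Fp : ∀ {t} → InFp t → T t ≡ 0#
  T-on-Fp {t} (n , t≡n·1) = begin
    T t              ≡⟨ cong T (trans t≡n·1 (sym (+-identityˡ _))) ⟩
    T (0# + n · 1#)  ≡⟨ T-periodic 0# n ⟩
    T 0#             ≡⟨ T-zero ⟩
    0#               ∎

  -- P(u + s) - P(u) - P(s) has degree < p (both P(u + s) and P(u) are monic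
  -- of degree p) and vanishes on 𝔽ₚ, so P is additive
  P-additive : ∀ t s → P (t + s) ≡ P t + P s
  P-additive t s = begin
    P (t + s)                            ≡⟨ solve 3 (λ A B C → A := (A :- B :- C) :+ B :+ C) refl (P (t + s)) (P t) (P s) ⟩
    (P (t + s) - P t - P s) + P t + P s  ≡⟨ cong (λ z → z + P t + P s) (vanishes defect-poly roots roots-injective on-roots t) ⟩
    0# + P t + P s                       ≡⟨ cong (_+ P s) (+-identityˡ _) ⟩
    P t + P s                            ∎
    where
    defect : Carrier → Carrier
    defect u = P (u + s) - P u - P s
    shifted-monic : Monic p (λ u → P (u + s))
    shifted-monic = let (c , eq) = ∏-monic p (λ j → s + j · 1#) in
      c , λ u → trans (∏-cong p (λ j _ → +-assoc u s (j · 1#))) (eq u)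
    defect-poly : PolyFn p defect
    defect-poly = poly-- (monic-difference shifted-monic (∏-monic p (λ j → j · 1#))) (poly-const 0<p (P s))
    roots : Fin p → Carrier
    roots i = toℕ i · 1#
    roots-injective : ∀ {i j} → roots i ≡ roots j → i ≡ j
    roots-injective {i} {j} eq = FinP.toℕ-injective (below-p-injective (FinP.toℕ<n i) (FinP.toℕ<n j) eq)
    on-roots : ∀ i → defect (roots i) ≡ 0#
    on-roots i = begin
      P (n · 1# + s) - P (n · 1#) - P s   ≡⟨ cong₂ (λ u v → u - v - P s) (trans (cong P (+-comm _ s)) (P-periodic s n))
                                                                         (P-root (n , refl)) ⟩
      P s - 0# - P s                      ≡⟨ solve 1 (λ x → x :- con (ℤ.+ 0) :- x := con (ℤ.+ 0)) refl (P s) ⟩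
      0#                                  ∎
      where n = toℕ i

  T-fibres : ∀ t s → T t ≡ T s → InFp (s - t)
  T-fibres t s Tt≡Ts with P t ≟ 0# | P s ≟ 0#
  ... | yes Pt≡0 | yes Ps≡0 = InFp-- (P-root⁻¹ Ps≡0) (P-root⁻¹ Pt≡0)
  ... | yes Pt≡0 | no Ps≢0  = ⊥-elim (E₀-nonzero (begin
    E₀          ≡⟨ sym (TP≡E₀ s Ps≢0) ⟩
    T s * P s   ≡⟨ cong (_* P s) (trans (sym Tt≡Ts) (T-on-Fp (P-root⁻¹ Pt≡0))) ⟩
    0# * P s    ≡⟨ zeroˡ _ ⟩
    0#          ∎))
  ... | no Pt≢0  | yes Ps≡0 = ⊥-elim (E₀-nonzero (begin
    E₀          ≡⟨ sym (TP≡E₀ t Pt≢0) ⟩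
    T t * P t   ≡⟨ cong (_* P t) (trans Tt≡Ts (T-on-Fp (P-root⁻¹ Ps≡0))) ⟩
    0# * P t    ≡⟨ zeroˡ _ ⟩
    0#          ∎))
  ... | no Pt≢0  | no Ps≢0  = P-root⁻¹ (+-cancelˡ (P t) (begin
    P t + P (s - t)    ≡⟨ +-comm _ _ ⟩
    P (s - t) + P t    ≡⟨ sym (P-additive (s - t) t) ⟩
    P ((s - t) + t)    ≡⟨ cong P (solve 2 (λ s t → (s :- t) :+ t := s) refl s t) ⟩
    P s                ≡⟨ sym Pt≡Ps ⟩
    P t                ≡⟨ sym (+-identityʳ _) ⟩
    P t + 0#           ∎))
    where
    Tt≢0 : T t ≢ 0#
    Tt≢0 Tt≡0 = E₀-nonzero (trans (sym (TP≡E₀ t Pt≢0)) (trans (cong (_* P t) Tt≡0) (zeroˡ _)))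
    Pt≡Ps : P t ≡ P s
    Pt≡Ps = *-cancelˡ Tt≢0 (trans (TP≡E₀ t Pt≢0) (trans (sym (TP≡E₀ s Ps≢0)) (cong (_* P s) (sym Tt≡Ts))))

  -- D̃_a inv (x) = ∑_j inv (a (x/a + j)) = inv a · T (x/a)
  D̃-rescale : ∀ a → a ≢ 0# → ∀ x → D̃ F p inv a x ≡ inv a * T (x * inv a)
  D̃-rescale a a≢0 x = begin
    sumUpTo F p (λ j → inv (x + j · a))              ≡⟨ sumUpTo≡∑ p _ ⟩
    ∑ p (λ j → inv (x + j · a))                      ≡⟨ ∑-cong p (λ j _ → trans (cong inv (factor-a j)) (inv-* a _)) ⟩
    ∑ p (λ j → inv a * inv (x * inv a + j · 1#))     ≡⟨ ∑-scale p (inv a) _ ⟩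
    inv a * T (x * inv a)                            ∎
    where
    factor-a : ∀ j → x + j · a ≡ a * (x * inv a + j · 1#)
    factor-a j = begin
      x + j · a                            ≡⟨ cong₂ _+_ (sym (trans (cong (x *_) (inv-r a a≢0)) (*-identityʳ x))) (·-scales j a) ⟩
      x * (a * inv a) + (j · 1#) * a
        ≡⟨ solve 4 (λ a x i J → x :* (a :* i) :+ J :* a := a :* (x :* i :+ J)) refl a x (inv a) (j · 1#) ⟩
      a * (x * inv a + j · 1#)             ∎

  D̃-fibres : ∀ a → a ≢ 0# → ∀ x y → D̃ F p inv a x ≡ D̃ F p inv a y → Σ ℕ λ n → y ≡ x + n · a
  D̃-fibres a a≢0 x y D̃x≡D̃y = back-to-line (T-fibres (x * inv a) (y * inv a) Tx≡Ty)
    where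
    Tx≡Ty : T (x * inv a) ≡ T (y * inv a)
    Tx≡Ty = *-cancelˡ (inv-nonzero a a≢0) (trans (sym (D̃-rescale a a≢0 x)) (trans D̃x≡D̃y (D̃-rescale a a≢0 y)))
    unscale : ∀ z → a * (z * inv a) ≡ z
    unscale z = begin
      a * (z * inv a)   ≡⟨ solve 3 (λ a z i → a :* (z :* i) := z :* (a :* i)) refl a z (inv a) ⟩
      z * (a * inv a)   ≡⟨ cong (z *_) (inv-r a a≢0) ⟩
      z * 1#            ≡⟨ *-identityʳ z ⟩
      z                 ∎
    back-to-line : InFp (y * inv a - x * inv a) → Σ ℕ λ n → y ≡ x + n · a
    back-to-line (n , y/a-x/a≡n·1) = n , (begin
      y                                          ≡⟨ sym (unscale y) ⟩
      a * (y * inv a)                            ≡⟨ cong (a *_) (solve 2 (λ u v → u := v :+ (u :- v)) refl (y * inv a) (x * inv a)) ⟩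
      a * (x * inv a + (y * inv a - x * inv a))  ≡⟨ cong (λ z → a * (x * inv a + z)) y/a-x/a≡n·1 ⟩
      a * (x * inv a + n · 1#)                   ≡⟨ distribˡ a _ _ ⟩
      a * (x * inv a) + a * (n · 1#)             ≡⟨ cong₂ _+_ (unscale x) (trans (*-comm a _) (sym (·-scales n a))) ⟩
      x + n · a                                  ∎)

unique-⊆-length : ∀ {A : Set} (xs ys : List A) → Unique xs → (∀ {z} → z ∈ xs → z ∈ ys) →
                  length xs ℕ.≤ length ys
unique-⊆-length []       ys _               _     = ℕ.z≤n
unique-⊆-length (x ∷ xs) ys (x∉xs ∷ unique) xs⊆ys with Membership.∈-∃++ (xs⊆ys (here refl))
... | us , vs , refl = ℕP.≤-trans (ℕ.s≤s (unique-⊆-length xs (us ++ vs) unique xs⊆us++vs))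
                                   (ℕP.≤-reflexive length-with-x)
  where
  xs⊆us++vs : ∀ {z} → z ∈ xs → z ∈ us ++ vs
  xs⊆us++vs z∈xs with Membership.∈-++⁻ us (xs⊆ys (there z∈xs))
  ... | inj₁ z∈us          = Membership.∈-++⁺ˡ z∈us
  ... | inj₂ (here refl)   = ⊥-elim (All.lookup x∉xs z∈xs refl)
  ... | inj₂ (there z∈vs)  = Membership.∈-++⁺ʳ us z∈vs
  length-with-x : suc (length (us ++ vs)) ≡ length (us ++ x ∷ vs)
  length-with-x = begin
    suc (length (us ++ vs))            ≡⟨ cong suc (ListP.length-++ us) ⟩
    suc (length us ℕ.+ length vs)      ≡⟨ sym (ℕP.+-suc _ _) ⟩
    length us ℕ.+ length (x ∷ vs)      ≡⟨ sym (ListP.length-++ us) ⟩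
    length (us ++ x ∷ vs)              ∎
    where open ≡-Reasoning

GAPN-from-fibres : (F : Field) (p : ℕ) {q : ℕ} (e : Fin q ↔ Field.Carrier F)
  (f : Field.Carrier F → Field.Carrier F) →
  (∀ a → a ≢ Field.0# F → ∀ x y → D̃ F p f a x ≡ D̃ F p f a y →
     Σ ℕ λ j → j ℕ.< p × y ≡ Field._+_ F x (Field._·_ F j a)) →
  IsGAPN F p e f
GAPN-from-fibres F p {q} e f on-line a a≢0 b = fibre-bound fibre fibre-unique in-fibre
  where
  open Field F
  fibre : List Carrier
  fibre = filter (λ x → D̃ F p f a x ≟ b) (map (Inverse.to e) (allFin q))
  enum-injective : ∀ {i j} → Inverse.to e i ≡ Inverse.to e j → i ≡ j
  enum-injective {i} {j} eq = trans (sym (Inverse.strictlyInverseʳ e i))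
                                    (trans (cong (Inverse.from e) eq) (Inverse.strictlyInverseʳ e j))
  fibre-unique : Unique fibre
  fibre-unique = UniqueP.filter⁺ (λ x → D̃ F p f a x ≟ b)
    (UniqueP.map⁺ enum-injective (UniqueP.allFin⁺ q))
  in-fibre : ∀ {z} → z ∈ fibre → D̃ F p f a z ≡ b
  in-fibre z∈ = proj₂ (Membership.∈-filter⁻ (λ x → D̃ F p f a x ≟ b) {xs = map (Inverse.to e) (allFin q)} z∈)
  line : Carrier → List Carrier
  line x₀ = map (λ j → x₀ + j · a) (upTo p)
  fibre-bound : ∀ zs → Unique zs → (∀ {z} → z ∈ zs → D̃ F p f a z ≡ b) → length zs ℕ.≤ p
  fibre-bound []        _      _   = ℕ.z≤n
  fibre-bound (x₀ ∷ zs) unique fib = ℕP.≤-trans (unique-⊆-length (x₀ ∷ zs) (line x₀) unique on-line-x₀)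
    (ℕP.≤-reflexive (trans (ListP.length-map _ (upTo p)) (ListP.length-upTo p)))
    where
    on-line-x₀ : ∀ {z} → z ∈ x₀ ∷ zs → z ∈ line x₀
    on-line-x₀ z∈ with on-line a a≢0 x₀ _ (trans (fib (here refl)) (sym (fib z∈)))
    ... | j , j<p , refl = Membership.∈-map⁺ (λ j → x₀ + j · a) (Membership.∈-upTo⁺ j<p)

odd-prime>2 : ∀ {p} → Prime p → p % 2 ≡ 1 → 2 ℕ.< p
odd-prime>2 {zero}                _       ()
odd-prime>2 {suc zero}          p-prime _  = ⊥-elim (¬prime[1] p-prime)
odd-prime>2 {suc (suc zero)}    _       ()
odd-prime>2 {suc (suc (suc _))} _       _  = ℕ.s≤s (ℕ.s≤s (ℕ.s≤s ℕ.z≤n))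

module PowerInversion (p n : ℕ) (p-prime : Prime p) (2<p : 2 ℕ.< p) (1≤n : 1 ℕ.≤ n)
    (F : Field) (e : Fin (p ℕ.^ n) ↔ Field.Carrier F) where
  open FieldAlgebra F
  open FiniteField F e using (characteristic; fermat)
  open ≡-Reasoning
  instance
    p-nonZero : ℕ.NonZero p
    p-nonZero = prime⇒nonZero p-prime

  q : ℕ
  q = p ℕ.^ n

  inv : Carrier → Carrier
  inv x = x ^ (q ℕ.∸ 2)

  2<q : 2 ℕ.< q
  2<q = ℕP.<-≤-trans 2<p (subst (ℕ._≤ q) (ℕP.*-identityʳ p) (ℕP.^-monoʳ-≤ p 1≤n))

  inv-0 : inv 0# ≡ 0#
  inv-0 = zero-power (ℕP.m<n⇒0<n∸m 2<q)
    where
    zero-power : ∀ {k} → 0 ℕ.< k → 0# ^ k ≡ 0#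
    zero-power {suc k} _ = zeroˡ _

  -- u · u^(q-2) = u^(q-1) = 1
  inv-r : ∀ u → u ≢ 0# → u * inv u ≡ 1#
  inv-r = fermat (sym (ℕP.m+[n∸m]≡n (ℕP.<⇒≤ 2<q)))

  -- (p · 1)^n = q · 1 = 0, and a field has no nonzero nilpotents
  ·-^ : ∀ m k → (m ℕ.^ k) · 1# ≡ (m · 1#) ^ k
  ·-^ m zero    = +-identityʳ 1#
  ·-^ m (suc k) = trans (·-* m (m ℕ.^ k)) (cong ((m · 1#) *_) (·-^ m k))

  nilpotent-zero : ∀ x k → x ^ k ≡ 0# → x ≡ 0#
  nilpotent-zero x zero    1≡0 = ⊥-elim (0≢1 (sym 1≡0))
  nilpotent-zero x (suc k) x^k+1≡0 with x ≟ 0#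
  ... | yes x≡0 = x≡0
  ... | no x≢0  = nilpotent-zero x k (zero-product x^k+1≡0 x≢0)

  p·1≡0 : p · 1# ≡ 0#
  p·1≡0 = nilpotent-zero (p · 1#) n (trans (sym (·-^ p n)) characteristic)

  open ReciprocalSum F p p-prime 2<p p·1≡0 inv inv-0 inv-r using (D̃-fibres)
  open PrimeSubfield F p p-prime p·1≡0 using (line-below-p)

  inverse-GAPN : IsGAPN F p e inv
  inverse-GAPN = GAPN-from-fibres F p e inv
    (λ a a≢0 x y same-value → line-below-p x a y (D̃-fibres a a≢0 x y same-value))

-- natural-number power, subtraction and order, named as in the statement
-- (inside the field modules above, _^_ is the power of the field)
open import Data.Nat using (_^_; _∸_; _≤_)

proposition3p2 : (p n : ℕ) → Prime p → p % 2 ≡ 1 → 1 ≤ n →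
    (F : Field) → (e : Fin (p ^ n) ↔ Field.Carrier F) →
    IsGAPN F p e (λ x → Field._^_ F x (p ^ n ∸ 2))
proposition3p2 p n p-prime p-odd 1≤n F e =
  PowerInversion.inverse-GAPN p n p-prime (odd-prime>2 p-prime p-odd) 1≤n F e
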